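{- Let $A\in\{\mathbb{Z},\mathbb{D}\}$. If a position $G$ has the $\Diamond_A$-property and every Left option and every Right option of $G$ lies in $\{A\mid A\}$, then $G\in A$.
   Context: Positions are short (finite, loop-free) combinatorial games $G=\{G^{\mathcal L}\mid G^{\mathcal R}\}$, where $G^{\mathcal L}$, $G^{\mathcal R}$ are the finite sets of Left and Right options; $G^L$, $G^R$ denote individual options. The relations $=,\le,<$ are the usual equality and partial order of games; $G\ngeq H$ means "$G<H$ or $G$ is fuzzy (incomparable) with $H$". $\mathbb{Z}$ denotes the integers and $\mathbb{D}$ the dyadic rationals, viewed as games. For $A\in\{\mathbb{Z},\mathbb{D}\}$, "$G\in A$" means $G$ equals some element of $A$, and $\{A\mid A\}$ is the set of positions equal to $\{a\mid b\}$ for some $a,b\in A$. The $A$-stops: $\mathrm{LS}_A(G)=\mathrm{RS}_A(G)=$ the element of $A$ equal to $G$ if $G\in A$; otherwise $\mathrm{LS}_A(G)=\max_{G^L}\mathrm{RS}_A(G^L)$ and $\mathrm{RS}_A(G)=\min_{G^R}\mathrm{LS}_A(G^R)$. Guide options: $\mathrm{gd}^L_A(G)=\emptyset$ if $G\in A$; if $G\notin A$ and some Left option equals $\mathrm{LS}_A(G)$, then $\mathrm{gd}^L_A(G)=\{G^L: G^L=\mathrm{LS}_A(G)\}$; otherwise $\mathrm{gd}^L_A(G)=\{G^L:\mathrm{RS}_A(G^L)=\mathrm{LS}_A(G)\}$. Dually, $\mathrm{gd}^R_A(G)=\emptyset$ if $G\in A$; if $G\notin A$ and some Right option equals $\mathrm{RS}_A(G)$,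 then $\mathrm{gd}^R_A(G)=\{G^R:G^R=\mathrm{RS}_A(G)\}$; otherwise $\mathrm{gd}^R_A(G)=\{G^R:\mathrm{LS}_A(G^R)=\mathrm{RS}_A(G)\}$. A position $G$ has the $\Diamond_A$-property if either $G\in A$, or there exist $G^L\in\mathrm{gd}^L_A(G)$, $G^R\in\mathrm{gd}^R_A(G)$ and $x\in A$ with $G^L\ngeq x$ and $x\ngeq G^R$. -}

module Defs where

open import Data.Nat as ℕ using (ℕ; zero; suc; _^_)
open import Data.Fin using (Fin)
open import Data.Integer as ℤ using (ℤ; +_; -[1+_]; _/ℕ_; _%ℕ_)
open import Data.Rational as ℚ using (ℚ; ↥_; ↧ₙ_)
open import Data.Product using (Σ; ∃; ∃-syntax; _×_; _,_; proj₁)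
open import Data.Sum using (_⊎_)
open import Relation.Nullary using (¬_)
open import Relation.Binary.PropositionalEquality using (_≡_)

-- Short games: finitely many Left options and Right options,
-- indexed by Fin (finite sets of options; repetitions are harmless).

data Game : Set where
  mk : (nL : ℕ) → (Fin nL → Game) → (nR : ℕ) → (Fin nR → Game) → Game

nL : Game → ℕ
nL (mk n _ _ _) = n

nR : Game → ℕ
nR (mk _ _ n _) = n

GL : (G : Game) → Fin (nL G) → Game
GL (mk _ l _ _) = l

GR : (G : Game) → Fin (nR G) → Game
GR (mk _ _ _ r) = r

infix 4 _≤g_ _≈g_
_≤g_ : Game → Game → Set
mk _ gl _ gr ≤g mk _ hl _ hr =
  (∀ i → ¬ (mk _ hl _ hr ≤g gl i)) × (∀ j → ¬ (hr j ≤g mk _ gl _ gr))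

_≈g_ : Game → Game → Set
G ≈g H = (G ≤g H) × (H ≤g G)

_≱g_ : Game → Game → Set
G ≱g H = ¬ (H ≤g G)

empty : Fin 0 → Game
empty ()

leftOnly : Game → Game
leftOnly g = mk 1 (λ _ → g) 0 empty

rightOnly : Game → Game
rightOnly g = mk 0 empty 1 (λ _ → g)

⟨_∣_⟩ : Game → Game → Game
⟨ g ∣ h ⟩ = mk 1 (λ _ → g) 1 (λ _ → h)

intGame : ℤ → Game
intGame (+ zero)        = mk 0 empty 0 empty
intGame (+ suc n)       = leftOnly (intGame (+ n))
intGame -[1+ zero ]     = rightOnly (intGame (+ zero))
intGame -[1+ suc n ]    = rightOnly (intGame -[1+ n ])

-- dyGame m k is the game m / 2^k :
--   k = 0          : the integer m
--   k > 0, m even  : (m/2) / 2^(k-1)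
--   k > 0, m odd   : { (m-1)/2^k | (m+1)/2^k }
--                  = { ((m-1)/2)/2^(k-1) | ((m+1)/2)/2^(k-1) }
dyGame : ℤ → ℕ → Game
dyGame m zero = intGame m
dyGame m (suc k) with m %ℕ 2
... | zero  = dyGame (m /ℕ 2) k
... | suc _ = ⟨ dyGame (m /ℕ 2) k ∣ dyGame (m /ℕ 2 ℤ.+ + 1) k ⟩

data NumSys : Set where
  ℤs 𝔻s : NumSys

InSys : NumSys → ℚ → Set
InSys ℤs q = ↧ₙ q ≡ 1
InSys 𝔻s q = ∃[ k ] ↧ₙ q ≡ 2 ^ k

El : NumSys → Set
El A = Σ ℚ (InSys A)

_≈A_ : ∀ {A} → El A → El A → Set
a ≈A b = proj₁ a ≡ proj₁ b

_≤A_ : ∀ {A} → El A → El A → Set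
a ≤A b = proj₁ a ℚ.≤ proj₁ b

toGame : (A : NumSys) → El A → Game
toGame ℤs (q , _)     = intGame (↥ q)
toGame 𝔻s (q , k , _) = dyGame (↥ q) k

_∈A_ : Game → NumSys → Set
G ∈A A = ∃[ a ] toGame A a ≈g G

_∈AA_ : Game → NumSys → Set
G ∈AA A = ∃[ a ] ∃[ b ] G ≈g ⟨ toGame A a ∣ toGame A b ⟩

-- A-stops, given relationally: IsLS A G s  means  LS_A(G) = s.

IsMax : ∀ {A} → (El A → Set) → El A → Set
IsMax P s = P s × (∀ t → P t → t ≤A s)

IsMin : ∀ {A} → (El A → Set) → El A → Set
IsMin P s = P s × (∀ t → P t → s ≤A t)

IsLS IsRS : (A : NumSys) → Game → El A → Set
IsLS A G@(mk _ gl _ _) s =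
  (toGame A s ≈g G) ⊎
  (¬ (G ∈A A) × IsMax (λ t → ∃[ i ] IsRS A (gl i) t) s)
IsRS A G@(mk _ _ _ gr) s =
  (toGame A s ≈g G) ⊎
  (¬ (G ∈A A) × IsMin (λ t → ∃[ j ] IsLS A (gr j) t) s)

InGdL : (A : NumSys) (G : Game) → Fin (nL G) → Set
InGdL A G i =
  ¬ (G ∈A A) × ∃[ s ] (IsLS A G s ×
    (((∃[ i′ ] GL G i′ ≈g toGame A s) × (GL G i ≈g toGame A s)) ⊎
     (¬ (∃[ i′ ] GL G i′ ≈g toGame A s) × IsRS A (GL G i) s)))

InGdR : (A : NumSys) (G : Game) → Fin (nR G) → Set
InGdR A G j =
  ¬ (G ∈A A) × ∃[ s ] (IsRS A G s ×
    (((∃[ j′ ] GR G j′ ≈g toGame A s) × (GR G j ≈g toGame A s)) ⊎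
     (¬ (∃[ j′ ] GR G j′ ≈g toGame A s) × IsLS A (GR G j) s)))

Diamond : NumSys → Game → Set
Diamond A G =
  (G ∈A A) ⊎
  (∃[ i ] ∃[ j ] ∃[ x ]
     (InGdL A G i × InGdR A G j × (GL G i ≱g toGame A x) × (toGame A x ≱g GR G j)))

{-# OPTIONS --safe #-}
-- Let x be the A-number given by the ◇_A-property. A-numbers are hereditarily
-- A-numbers, so by the simplicity argument G ∈ A as soon as x fits G, that is
-- G^L ≱ x ≱ G^R for all options; ◇_A provides this for the guides. Suppose
-- x ≤ G^L. Stops are monotone, so x ≤ RS(G^L), and RS(G^L) ≤ LS(G). If G^L₀
-- equals LS(G) this contradicts G^L₀ ≱ x. Otherwise G^L₀ = {a₀ | b₀} ∉ A, so no
-- element of A lies strictly between a₀ and b₀, and LS(G) = RS(G^L₀) ≤ b₀ ≤ x.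
-- Hence RS(G^L) ≈ LS(G), which no Left option equals, so G^L = {a | b} ∉ A too;
-- but then RS(G^L) ≥ b > x because x ≤ G^L. Right options are dual.

module Submission where

open import Defs

open import Data.Empty using (⊥; ⊥-elim)
open import Data.Fin as Fin using (Fin) renaming (zero to fzero)
open import Data.Fin.Properties using (any?)
import Data.Fin.Properties as Finₚ
open import Data.Integer as ℤ using (ℤ; +_; -[1+_]; +≤+; -≤+; _%ℕ_; _/ℕ_)
import Data.Integer.DivMod as ℤ
import Data.Integer.Divisibility.Signed as ℤ∣
import Data.Integer.Properties as ℤₚ
open import Data.Integer.Tactic.RingSolver using (solve-∀)
open import Data.Nat as ℕ using (ℕ; zero; suc; z≤n; s≤s; _^_)
import Data.Nat.Properties as ℕₚ
open import Data.Nat.Coprimality using (Coprime; coprime-divisor)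
import Data.Nat.Coprimality as Coprime
open import Data.Nat.Divisibility using (_∣_; ∣-trans; ∣1⇒≡1; ∣⇒≤)
open import Data.Nat.Primality using (prime⇒irreducible; prime[2])
open import Data.Rational as ℚ using (ℚ; mkℚ; ↥_; ↧ₙ_)
import Data.Rational.Properties as ℚₚ
open import Data.Product using (∃; ∃₂; _×_; _,_; proj₁; proj₂)
open import Data.Rational.Unnormalised as ℚᵘ using (ℚᵘ; mkℚᵘ; _≃_; *≡*; *≤*)
import Data.Rational.Unnormalised.Properties as ℚᵘₚ
open import Data.Sum using (_⊎_; inj₁; inj₂; [_,_])
open import Relation.Binary using (IsPreorder; Preorder; TotalPreorder; Decidable)
import Relation.Binary.Construct.Flip.EqAndOrd as Flip
open import Effect.Monad using (RawMonad)
open import Level using (0ℓ)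
import Relation.Binary.Reasoning.Preorder
open import Relation.Binary.PropositionalEquality
  using (_≡_; refl; sym; trans; cong; cong₂; subst; module ≡-Reasoning)
open import Relation.Nullary using (¬_; Dec; yes; no)
open import Relation.Nullary.Decidable using (decidable-stable; ¬¬-excluded-middle)
open import Relation.Nullary.Negation using (¬¬-Monad; ¬¬-map)

variable
  X Y Z G K : Game
  m m′ : ℤ
  k k′ : ℕ
  A : NumSys

≤g-intro : (∀ i → GL X i ≱g Y) → (∀ j → X ≱g GR Y j) → X ≤g Y
≤g-intro {mk _ _ _ _} {mk _ _ _ _} l r = l , r

≤g⇒GL≱g : X ≤g Y → ∀ i → GL X i ≱g Y
≤g⇒GL≱g {mk _ _ _ _} {mk _ _ _ _} = proj₁

≤g⇒≱gGR : X ≤g Y → ∀ j → X ≱g GR Y j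
≤g⇒≱gGR {mk _ _ _ _} {mk _ _ _ _} = proj₂

≤g-refl : ∀ X → X ≤g X
≤g-refl (mk _ l _ r) =
  (λ i X≤l → ≤g⇒GL≱g X≤l i (≤g-refl (l i))) , (λ j r≤X → ≤g⇒≱gGR r≤X j (≤g-refl (r j)))

≤g-trans : X ≤g Y → Y ≤g Z → X ≤g Z
≤g-trans {mk _ _ _ _} {mk _ _ _ _} {mk _ _ _ _} (xl , xr) (yl , yr) =
  (λ i Z≤xl → xl i (≤g-trans (yl , yr) Z≤xl)) , (λ j zr≤X → yr j (≤g-trans zr≤X (xl , xr)))

GL≱g : ∀ X i → GL X i ≱g X
GL≱g X = ≤g⇒GL≱g (≤g-refl X)

≱gGR : ∀ X j → X ≱g GR X j
≱gGR X = ≤g⇒≱gGR (≤g-refl X)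

_≤g?_ : Decidable _≤g_
mk _ l _ r ≤g? Y@(mk _ _ _ r′) with any? (λ i → Y ≤g? l i) | any? (λ j → r′ j ≤g? mk _ l _ r)
... | no ¬l | no ¬r = yes ((λ i h → ¬l (i , h)) , (λ j h → ¬r (j , h)))
... | yes (i , h) | _ = no (λ X≤Y → ≤g⇒GL≱g X≤Y i h)
... | no _ | yes (j , h) = no (λ X≤Y → ≤g⇒≱gGR X≤Y j h)

≰g-witness : ¬ X ≤g Y → (∃ λ i → Y ≤g GL X i) ⊎ (∃ λ j → GR Y j ≤g X)
≰g-witness {X} {Y} X≰Y with any? (λ i → Y ≤g? GL X i) | any? (λ j → GR Y j ≤g? X)
... | yes l | _ = inj₁ l
... | no _ | yes r = inj₂ r
... | no ¬l | no ¬r = ⊥-elim (X≰Y (≤g-intro (λ i h → ¬l (i , h)) (λ j h → ¬r (j , h))))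

≈g-refl : X ≈g X
≈g-refl {X} = ≤g-refl X , ≤g-refl X

≈g-sym : X ≈g Y → Y ≈g X
≈g-sym (p , q) = q , p

≈g-trans : X ≈g Y → Y ≈g Z → X ≈g Z
≈g-trans (p , q) (p′ , q′) = ≤g-trans p p′ , ≤g-trans q′ q

≤g-isPreorder : IsPreorder _≈g_ _≤g_
≤g-isPreorder = record
  { isEquivalence = record { refl = ≈g-refl ; sym = ≈g-sym ; trans = ≈g-trans }
  ; reflexive     = proj₁
  ; trans         = ≤g-trans
  }

≤g-preorder : Preorder _ _ _
≤g-preorder = record { isPreorder = ≤g-isPreorder }

module ≤g-Reasoning = Relation.Binary.Reasoning.Preorder ≤g-preorder

-- Dyadic rationals

mersenne : ℕ → ℕ
mersenne zero    = zero
mersenne (suc k) = suc (2 ℕ.* mersenne k)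

suc-mersenne : ∀ k → suc (mersenne k) ≡ 2 ^ k
suc-mersenne zero    = refl
suc-mersenne (suc k) = trans (sym (ℕₚ.*-suc 2 (mersenne k))) (cong (2 ℕ.*_) (suc-mersenne k))

-- ℚᵘ stores the denominator minus one.
dyadic : ℤ → ℕ → ℚᵘ
dyadic m k = mkℚᵘ m (mersenne k)

dyadic-rescale : ∀ m k d → dyadic m k ≃ dyadic (m ℤ.* + (2 ^ d)) (k ℕ.+ d)
dyadic-rescale m k d = *≡* (begin
  m ℤ.* + suc (mersenne (k ℕ.+ d))    ≡⟨ cong (λ n → m ℤ.* + n) (suc-mersenne (k ℕ.+ d)) ⟩
  m ℤ.* + (2 ^ (k ℕ.+ d))             ≡⟨ cong (λ n → m ℤ.* + n) (ℕₚ.^-distribˡ-+-* 2 k d) ⟩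
  m ℤ.* + (2 ^ k ℕ.* 2 ^ d)           ≡⟨ cong (m ℤ.*_) (ℤₚ.pos-* (2 ^ k) (2 ^ d)) ⟩
  m ℤ.* (+ (2 ^ k) ℤ.* + (2 ^ d))     ≡⟨ cong (m ℤ.*_) (ℤₚ.*-comm (+ (2 ^ k)) (+ (2 ^ d))) ⟩
  m ℤ.* (+ (2 ^ d) ℤ.* + (2 ^ k))     ≡⟨ sym (ℤₚ.*-assoc m (+ (2 ^ d)) (+ (2 ^ k))) ⟩
  m ℤ.* + (2 ^ d) ℤ.* + (2 ^ k)       ≡⟨ cong (λ n → m ℤ.* + (2 ^ d) ℤ.* + n) (sym (suc-mersenne k)) ⟩
  m ℤ.* + (2 ^ d) ℤ.* + suc (mersenne k) ∎)
  where open ≡-Reasoning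

m*2≡m+m : ∀ m → m ℤ.* + 2 ≡ m ℤ.+ m
m*2≡m+m = solve-∀

dyadic-double : ∀ {h n} k → h ℤ.+ h ≡ n → dyadic h k ≃ dyadic n (suc k)
dyadic-double {h} k refl = ℚᵘₚ.≃-trans (dyadic-rescale h k 1)
  (ℚᵘₚ.≃-reflexive (cong₂ dyadic (m*2≡m+m h) (ℕₚ.+-comm k 1)))

dyadic-mono-≤ : m ℤ.≤ m′ → dyadic m k ℚᵘ.≤ dyadic m′ k
dyadic-mono-≤ {k = k} m≤m′ = *≤* (ℤₚ.*-monoʳ-≤-nonNeg (+ suc (mersenne k)) m≤m′)

dyadic-mono-< : m ℤ.< m′ → dyadic m k ℚᵘ.< dyadic m′ k
dyadic-mono-< {k = k} m<m′ = ℚᵘ.*<* (ℤₚ.*-monoʳ-<-pos (+ suc (mersenne k)) m<m′)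

dyadic-cancel-< : dyadic m k ℚᵘ.< dyadic m′ k → m ℤ.< m′
dyadic-cancel-< {k = k} (ℚᵘ.*<* lt) = ℤₚ.*-cancelʳ-<-nonNeg (+ suc (mersenne k)) lt

dyadic-pred-< : ∀ m k → dyadic (ℤ.pred m) k ℚᵘ.< dyadic m k
dyadic-pred-< m k = dyadic-mono-< (ℤₚ.i≤pred[j]⇒i<j ℤₚ.≤-refl)

dyadic-<-suc : ∀ m k → dyadic m k ℚᵘ.< dyadic (ℤ.suc m) k
dyadic-<-suc m k = dyadic-mono-< (ℤₚ.suc[i]≤j⇒i<j ℤₚ.≤-refl)

-- Between m/2^k and an option at distance 2^-k there is no dyadic of exponent ≤ k.
dyadic-left-gap : dyadic (ℤ.pred m) k ℚᵘ.< dyadic m′ k′ → k′ ℕ.≤ k → dyadic m k ℚᵘ.≤ dyadic m′ k′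
dyadic-left-gap {m} {k} {m′} {k′} lt k′≤k with ℕₚ.m≤n⇒∃[o]m+o≡n k′≤k
... | d , refl = ℚᵘₚ.≤-respʳ-≃ (ℚᵘₚ.≃-sym (dyadic-rescale m′ k′ d)) (dyadic-mono-≤
  (subst (ℤ._≤ _) (ℤₚ.suc-pred m)
    (ℤₚ.i<j⇒suc[i]≤j (dyadic-cancel-< (ℚᵘₚ.<-respʳ-≃ (dyadic-rescale m′ k′ d) lt)))))

dyadic-right-gap : dyadic m k ℚᵘ.< dyadic (ℤ.suc m′) k′ → k ℕ.≤ k′ → dyadic m k ℚᵘ.≤ dyadic m′ k′
dyadic-right-gap {m} {k} {m′} {k′} lt k≤k′ with ℕₚ.m≤n⇒∃[o]m+o≡n k≤k′
... | d , refl = ℚᵘₚ.≤-respˡ-≃ (ℚᵘₚ.≃-sym (dyadic-rescale m k d)) (dyadic-mono-≤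
  (subst (_ ℤ.≤_) (ℤₚ.pred-suc m′)
    (ℤₚ.i<j⇒i≤pred[j] (dyadic-cancel-< (ℚᵘₚ.<-respˡ-≃ (dyadic-rescale m k d) lt)))))

-- q lies above the left options of a form of m/2^k; only integers m ≤ 0 have none.
data AboveLeft : ℤ → ℕ → ℚᵘ → Set where
  no-left : ∀ {m q} → m ℤ.≤ + 0 → AboveLeft m 0 q
  left    : ∀ {m k q} → dyadic (ℤ.pred m) k ℚᵘ.< q → AboveLeft m k q

data BelowRight : ℤ → ℕ → ℚᵘ → Set where
  no-right : ∀ {m q} → + 0 ℤ.≤ m → BelowRight m 0 q
  right    : ∀ {m k q} → q ℚᵘ.< dyadic (ℤ.suc m) k → BelowRight m k q

dyadic-fits-≤ : AboveLeft m k (dyadic m′ k′) → BelowRight m′ k′ (dyadic m k) →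
                dyadic m k ℚᵘ.≤ dyadic m′ k′
dyadic-fits-≤ (no-left m≤0) (no-right 0≤m′) = dyadic-mono-≤ (ℤₚ.≤-trans m≤0 0≤m′)
dyadic-fits-≤ (left lt)     (no-right _)    = dyadic-left-gap lt z≤n
dyadic-fits-≤ (no-left _)   (right lt)      = dyadic-right-gap lt z≤n
dyadic-fits-≤ {k = k} {k′ = k′} (left lt) (right lt′) with ℕₚ.≤-total k′ k
... | inj₁ k′≤k = dyadic-left-gap lt k′≤k
... | inj₂ k≤k′ = dyadic-right-gap lt′ k≤k′

-- Dyadic forms: X has value m/2^k, Left options (m − 1)/2^k, Right options (m + 1)/2^k.

data Dyadic : Game → ℤ → ℕ → Set where
  zero  : Dyadic (intGame (+ 0)) (+ 0) 0
  pos   : ∀ {X n} → Dyadic X (+ n) 0 → Dyadic (leftOnly X) (+ suc n) 0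
  neg   : ∀ {X n} → Dyadic X (ℤ.suc -[1+ n ]) 0 → Dyadic (rightOnly X) -[1+ n ] 0
  split : ∀ {X Y ml kl mr kr} m k → Dyadic X ml kl → Dyadic Y mr kr →
          dyadic ml kl ≃ dyadic (ℤ.pred m) (suc k) → dyadic mr kr ≃ dyadic (ℤ.suc m) (suc k) →
          Dyadic ⟨ X ∣ Y ⟩ m (suc k)

mutual
  ≤g⇒dyadic-≤ : Dyadic X m k → Dyadic Y m′ k′ → X ≤g Y → dyadic m k ℚᵘ.≤ dyadic m′ k′
  ≤g⇒dyadic-≤ dX dY X≤Y =
    dyadic-fits-≤ (above-left dX dY (≤g⇒GL≱g X≤Y)) (below-right dX dY (≤g⇒≱gGR X≤Y))

  above-left : Dyadic X m k → Dyadic Y m′ k′ → (∀ i → GL X i ≱g Y) → AboveLeft m k (dyadic m′ k′)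
  above-left zero    _ _ = no-left ℤₚ.≤-refl
  above-left (neg _) _ _ = no-left -≤+
  above-left (pos dL) dY XL≱Y =
    left (ℚᵘₚ.≰⇒> (λ Y≤XL → XL≱Y fzero (dyadic-≤⇒≤g dY dL Y≤XL)))
  above-left (split _ _ dL _ eL _) dY XL≱Y =
    left (ℚᵘₚ.<-respˡ-≃ eL (ℚᵘₚ.≰⇒> (λ Y≤XL → XL≱Y fzero (dyadic-≤⇒≤g dY dL Y≤XL))))

  below-right : Dyadic X m k → Dyadic Y m′ k′ → (∀ j → X ≱g GR Y j) → BelowRight m′ k′ (dyadic m k)
  below-right _ zero    _ = no-right ℤₚ.≤-refl
  below-right _ (pos _) _ = no-right (+≤+ z≤n)
  below-right dX (neg dR) X≱YR =
    right (ℚᵘₚ.≰⇒> (λ YR≤X → X≱YR fzero (dyadic-≤⇒≤g dR dX YR≤X)))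
  below-right dX (split _ _ _ dR _ eR) X≱YR =
    right (ℚᵘₚ.<-respʳ-≃ eR (ℚᵘₚ.≰⇒> (λ YR≤X → X≱YR fzero (dyadic-≤⇒≤g dR dX YR≤X))))

  dyadic-≤⇒≤g : Dyadic X m k → Dyadic Y m′ k′ → dyadic m k ℚᵘ.≤ dyadic m′ k′ → X ≤g Y
  dyadic-≤⇒≤g dX dY X≤Y = ≤g-intro (dyadic-≤⇒GL≱g dX dY X≤Y) (dyadic-≤⇒≱gGR dX dY X≤Y)

  dyadic-≤⇒GL≱g : Dyadic X m k → Dyadic Y m′ k′ → dyadic m k ℚᵘ.≤ dyadic m′ k′ → ∀ i → GL X i ≱g Y
  dyadic-≤⇒GL≱g (pos {n = n} dL) dY X≤Y _ Y≤XL =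
    ℚᵘₚ.<⇒≱ (ℚᵘₚ.<-≤-trans (dyadic-pred-< (+ suc n) 0) X≤Y) (≤g⇒dyadic-≤ dY dL Y≤XL)
  dyadic-≤⇒GL≱g (split m k dL _ eL _) dY X≤Y _ Y≤XL =
    ℚᵘₚ.<⇒≱ (ℚᵘₚ.<-respˡ-≃ (ℚᵘₚ.≃-sym eL) (ℚᵘₚ.<-≤-trans (dyadic-pred-< m (suc k)) X≤Y))
             (≤g⇒dyadic-≤ dY dL Y≤XL)

  dyadic-≤⇒≱gGR : Dyadic X m k → Dyadic Y m′ k′ → dyadic m k ℚᵘ.≤ dyadic m′ k′ → ∀ j → X ≱g GR Y j
  dyadic-≤⇒≱gGR dX (neg {n = n} dR) X≤Y _ YR≤X =
    ℚᵘₚ.<⇒≱ (ℚᵘₚ.≤-<-trans X≤Y (dyadic-<-suc -[1+ n ] 0)) (≤g⇒dyadic-≤ dR dX YR≤X)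
  dyadic-≤⇒≱gGR dX (split m k _ dR _ eR) X≤Y _ YR≤X =
    ℚᵘₚ.<⇒≱ (ℚᵘₚ.<-respʳ-≃ (ℚᵘₚ.≃-sym eR) (ℚᵘₚ.≤-<-trans X≤Y (dyadic-<-suc m (suc k))))
             (≤g⇒dyadic-≤ dR dX YR≤X)

_hasValue_ : Game → ℚᵘ → Set
X hasValue q = ∃₂ λ m k → Dyadic X m k × dyadic m k ≃ q

hasValue-≤g⇒≤ : ∀ {p q} → X hasValue p → Y hasValue q → X ≤g Y → p ℚᵘ.≤ q
hasValue-≤g⇒≤ (_ , _ , dX , eX) (_ , _ , dY , eY) X≤Y =
  ℚᵘₚ.≤-respˡ-≃ eX (ℚᵘₚ.≤-respʳ-≃ eY (≤g⇒dyadic-≤ dX dY X≤Y))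

hasValue-≤⇒≤g : ∀ {p q} → X hasValue p → Y hasValue q → p ℚᵘ.≤ q → X ≤g Y
hasValue-≤⇒≤g (_ , _ , dX , eX) (_ , _ , dY , eY) p≤q =
  dyadic-≤⇒≤g dX dY (ℚᵘₚ.≤-respˡ-≃ (ℚᵘₚ.≃-sym eX) (ℚᵘₚ.≤-respʳ-≃ (ℚᵘₚ.≃-sym eY) p≤q))

intGame-Dyadic : ∀ z → Dyadic (intGame z) z 0
intGame-Dyadic (+ zero)     = zero
intGame-Dyadic (+ suc n)    = pos (intGame-Dyadic (+ n))
intGame-Dyadic -[1+ zero ]  = neg zero
intGame-Dyadic -[1+ suc n ] = neg (intGame-Dyadic -[1+ n ])

halving : ∀ m {r} → m %ℕ 2 ≡ r → m ≡ + r ℤ.+ m /ℕ 2 ℤ.* + 2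
halving m eq = subst (λ r → m ≡ + r ℤ.+ m /ℕ 2 ℤ.* + 2) eq (ℤ.a≡a%ℕn+[a/ℕn]*n m 2)

even-halving : ∀ m → m %ℕ 2 ≡ 0 → m /ℕ 2 ℤ.+ m /ℕ 2 ≡ m
even-halving m eq = sym (trans (halving m eq) (lemma (m /ℕ 2)))
  where lemma : ∀ h → + 0 ℤ.+ h ℤ.* + 2 ≡ h ℤ.+ h
        lemma = solve-∀

odd-halving-pred : ∀ m → m %ℕ 2 ≡ 1 → m /ℕ 2 ℤ.+ m /ℕ 2 ≡ ℤ.pred m
odd-halving-pred m eq = sym (trans (cong ℤ.pred (halving m eq)) (lemma (m /ℕ 2)))
  where lemma : ∀ h → ℤ.pred (+ 1 ℤ.+ h ℤ.* + 2) ≡ h ℤ.+ h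
        lemma h = trans (ℤₚ.pred-suc (h ℤ.* + 2)) (m*2≡m+m h)

odd-halving-suc : ∀ m → m %ℕ 2 ≡ 1 → (m /ℕ 2 ℤ.+ + 1) ℤ.+ (m /ℕ 2 ℤ.+ + 1) ≡ ℤ.suc m
odd-halving-suc m eq = sym (trans (cong ℤ.suc (halving m eq)) (lemma (m /ℕ 2)))
  where lemma : ∀ h → + 1 ℤ.+ (+ 1 ℤ.+ h ℤ.* + 2) ≡ (h ℤ.+ + 1) ℤ.+ (h ℤ.+ + 1)
        lemma = solve-∀

dyGame-hasValue : ∀ m k → dyGame m k hasValue dyadic m k
dyGame-hasValue m zero = m , 0 , intGame-Dyadic m , ℚᵘₚ.≃-refl
dyGame-hasValue m (suc k) with m %ℕ 2 in eq | ℤ.n%ℕd<d m 2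
... | zero | _ =
  let (m′ , k′ , d , e) = dyGame-hasValue (m /ℕ 2) k
  in m′ , k′ , d , ℚᵘₚ.≃-trans e (dyadic-double k (even-halving m eq))
... | suc zero | _ =
  let (ml , kl , dL , eL) = dyGame-hasValue (m /ℕ 2) k
      (mr , kr , dR , eR) = dyGame-hasValue (m /ℕ 2 ℤ.+ + 1) k
  in m , suc k ,
     split m k dL dR (ℚᵘₚ.≃-trans eL (dyadic-double k (odd-halving-pred m eq)))
                     (ℚᵘₚ.≃-trans eR (dyadic-double k (odd-halving-suc m eq))) ,
     ℚᵘₚ.≃-refl
... | suc (suc _) | s≤s (s≤s ())

dyGame-odd : ∀ {m r} k → m %ℕ 2 ≡ suc r →
             dyGame m (suc k) ≡ ⟨ dyGame (m /ℕ 2) k ∣ dyGame (m /ℕ 2 ℤ.+ + 1) k ⟩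
dyGame-odd k eq rewrite eq = refl

exponent : ∀ A → El A → ℕ
exponent ℤs _           = 0
exponent 𝔻s (_ , k , _) = k

↧ₙ≡2^exponent : ∀ A (a : El A) → ↧ₙ proj₁ a ≡ 2 ^ exponent A a
↧ₙ≡2^exponent ℤs (_ , e)     = e
↧ₙ≡2^exponent 𝔻s (_ , _ , e) = e

toℚᵘ≡dyadic : ∀ A (a : El A) → ℚ.toℚᵘ (proj₁ a) ≡ dyadic (↥ proj₁ a) (exponent A a)
toℚᵘ≡dyadic A a@(mkℚ n _ _ , _) =
  cong (mkℚᵘ n) (ℕₚ.suc-injective (trans (↧ₙ≡2^exponent A a) (sym (suc-mersenne (exponent A a)))))

toGame≡dyGame : ∀ A (a : El A) → toGame A a ≡ dyGame (↥ proj₁ a) (exponent A a)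
toGame≡dyGame ℤs _ = refl
toGame≡dyGame 𝔻s _ = refl

toGame-hasValue : ∀ A (a : El A) → toGame A a hasValue ℚ.toℚᵘ (proj₁ a)
toGame-hasValue A a rewrite toGame≡dyGame A a | toℚᵘ≡dyadic A a = dyGame-hasValue _ _

toGame-mono-≤ : ∀ {a b : El A} → a ≤A b → toGame A a ≤g toGame A b
toGame-mono-≤ {A} {a} {b} a≤b =
  hasValue-≤⇒≤g (toGame-hasValue A a) (toGame-hasValue A b) (ℚₚ.toℚᵘ-mono-≤ a≤b)

toGame-cancel-≤ : ∀ {a b : El A} → toGame A a ≤g toGame A b → a ≤A b
toGame-cancel-≤ {A} {a} {b} a≤b =
  ℚₚ.toℚᵘ-cancel-≤ (hasValue-≤g⇒≤ (toGame-hasValue A a) (toGame-hasValue A b) a≤b)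

toGame-≱g⇒≤g : ∀ {a b : El A} → toGame A a ≱g toGame A b → toGame A a ≤g toGame A b
toGame-≱g⇒≤g {A} {a} {b} b≰a with ℚₚ.≤-total (proj₁ a) (proj₁ b)
... | inj₁ a≤b = toGame-mono-≤ {A} {a} {b} a≤b
... | inj₂ b≤a = ⊥-elim (b≰a (toGame-mono-≤ {A} {b} {a} b≤a))

integer : ∀ A → ℤ → El A
integer ℤs z = mkℚ z 0 (Coprime.sym (Coprime.1-coprimeTo _)) , refl
integer 𝔻s z = mkℚ z 0 (Coprime.sym (Coprime.1-coprimeTo _)) , 0 , refl

odd-divisor-coprime-2 : ∀ {n d} → ¬ 2 ∣ n → d ∣ n → Coprime d 2
odd-divisor-coprime-2 2∤n d∣n (e∣d , e∣2) with prime⇒irreducible prime[2] e∣2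
... | inj₁ e≡1 = e≡1
... | inj₂ refl = ⊥-elim (2∤n (∣-trans e∣d d∣n))

odd-coprime-2^ : ∀ {n} k → ¬ 2 ∣ n → Coprime n (2 ^ k)
odd-coprime-2^ zero    _   (_ , d∣1)   = ∣1⇒≡1 d∣1
odd-coprime-2^ (suc k) 2∤n (d∣n , d∣2^k) =
  odd-coprime-2^ k 2∤n (d∣n , coprime-divisor (odd-divisor-coprime-2 2∤n d∣n) d∣2^k)

odd-∤ : ∀ m → m %ℕ 2 ≡ 1 → ¬ 2 ∣ ℤ.∣ m ∣
odd-∤ m eq 2∣m = ℕₚ.1+n≰n (∣⇒≤ (ℤ∣.∣⇒∣ᵤ 2∣1))
  where
    2∣1 : + 2 ℤ∣.∣ + 1
    2∣1 = ℤ∣.∣m+n∣n⇒∣m (subst (+ 2 ℤ∣.∣_) (halving m eq) (ℤ∣.∣ᵤ⇒∣ 2∣m)) (ℤ∣.∣n⇒∣m*n (m /ℕ 2) ℤ∣.∣-refl)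

odd-element : ∀ m k → m %ℕ 2 ≡ 1 → El 𝔻s
odd-element m k eq =
  mkℚ m (mersenne (suc k))
      (subst (Coprime ℤ.∣ m ∣) (sym (suc-mersenne (suc k))) (odd-coprime-2^ (suc k) (odd-∤ m eq))) ,
  suc k , suc-mersenne (suc k)

toGame-integer : ∀ A z → toGame A (integer A z) ≡ intGame z
toGame-integer ℤs _ = refl
toGame-integer 𝔻s _ = refl

≡⇒∈A : ∀ (a : El A) → toGame A a ≡ X → X ∈A A
≡⇒∈A a refl = a , ≈g-refl

integer-∈A : ∀ A z → intGame z ∈A A
integer-∈A A z = ≡⇒∈A (integer A z) (toGame-integer A z)

∈A-resp-≈g : X ≈g Y → X ∈A A → Y ∈A A
∈A-resp-≈g X≈Y (a , a≈X) = a , ≈g-trans a≈X X≈Y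

∈A-≱g⇒≤g : X ∈A A → Y ∈A A → X ≱g Y → X ≤g Y
∈A-≱g⇒≤g {X} {A} {Y} (a , a≈X) (b , b≈Y) X≱Y = begin
  X           ≈⟨ ≈g-sym a≈X ⟩
  toGame A a  ≲⟨ toGame-≱g⇒≤g {A} {a} {b} (λ b≤a → X≱Y (begin
                   Y ≈⟨ ≈g-sym b≈Y ⟩ toGame A b ≲⟨ b≤a ⟩ toGame A a ≈⟨ a≈X ⟩ X ∎)) ⟩
  toGame A b  ≈⟨ b≈Y ⟩
  Y           ∎
  where open ≤g-Reasoning

data HereditarilyIn (A : NumSys) : Game → Set where
  hereditary : X ∈A A → (∀ i → HereditarilyIn A (GL X i)) → (∀ j → HereditarilyIn A (GR X j)) →
               HereditarilyIn A X

hereditary-∈A : HereditarilyIn A X → X ∈A A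
hereditary-∈A (hereditary X∈A _ _) = X∈A

intGame-hereditary : ∀ A z → HereditarilyIn A (intGame z)
intGame-hereditary A z@(+ zero)      = hereditary (≡⇒∈A _ (toGame-integer A z)) (λ ()) (λ ())
intGame-hereditary A z@(+ suc n)     =
  hereditary (≡⇒∈A _ (toGame-integer A z)) (λ _ → intGame-hereditary A (+ n)) (λ ())
intGame-hereditary A z@(-[1+ zero ]) =
  hereditary (≡⇒∈A _ (toGame-integer A z)) (λ ()) (λ _ → intGame-hereditary A (+ 0))
intGame-hereditary A z@(-[1+ suc n ]) =
  hereditary (≡⇒∈A _ (toGame-integer A z)) (λ ()) (λ _ → intGame-hereditary A -[1+ n ])

dyGame-hereditary : ∀ m k → HereditarilyIn 𝔻s (dyGame m k)
dyGame-hereditary m zero = intGame-hereditary 𝔻s m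
dyGame-hereditary m (suc k) with m %ℕ 2 in eq | ℤ.n%ℕd<d m 2
... | zero        | _ = dyGame-hereditary (m /ℕ 2) k
... | suc zero    | _ = hereditary (≡⇒∈A (odd-element m k eq) (dyGame-odd {m} k eq))
                          (λ _ → dyGame-hereditary (m /ℕ 2) k)
                          (λ _ → dyGame-hereditary (m /ℕ 2 ℤ.+ + 1) k)
... | suc (suc _) | s≤s (s≤s ())

toGame-hereditary : ∀ A (a : El A) → HereditarilyIn A (toGame A a)
toGame-hereditary ℤs (q , _)     = intGame-hereditary ℤs (↥ q)
toGame-hereditary 𝔻s (q , k , _) = dyGame-hereditary (↥ q) k

GL≤g : HereditarilyIn A X → ∀ i → GL X i ≤g X
GL≤g {X = X} (hereditary X∈A hL _) i = ∈A-≱g⇒≤g (hereditary-∈A (hL i)) X∈A (GL≱g X i)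

≤gGR : HereditarilyIn A X → ∀ j → X ≤g GR X j
≤gGR {X = X} (hereditary X∈A _ hR) j = ∈A-≱g⇒≤g X∈A (hereditary-∈A (hR j)) (≱gGR X j)

Fits : Game → Game → Set
Fits X G = (∀ i → GL G i ≱g X) × (∀ j → X ≱g GR G j)

-- Simplicity: move from X to an option of X that still fits G until X ≈ G.
fits⇒∈A : HereditarilyIn A X → Fits X G → G ∈A A
fits⇒∈A {X = X} {G = G} hX@(hereditary X∈A hL hR) (GL≱X , X≱GR)
  with any? (λ i → G ≤g? GL X i) | any? (λ j → GR X j ≤g? G)
... | yes (i , G≤XL) | _ = fits⇒∈A (hL i)
  ( (λ i′ XL≤GL → GL≱g G i′ (≤g-trans G≤XL XL≤GL))
  , (λ j GR≤XL → X≱GR j (≤g-trans GR≤XL (GL≤g hX i))) )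
... | no _ | yes (j , XR≤G) = fits⇒∈A (hR j)
  ( (λ i XR≤GL → GL≱X i (≤g-trans (≤gGR hX j) XR≤GL))
  , (λ j′ GR≤XR → ≱gGR G j′ (≤g-trans GR≤XR XR≤G)) )
... | no G≰XL | no XR≰G = ∈A-resp-≈g
  ( ≤g-intro (λ i G≤XL → G≰XL (i , G≤XL)) X≱GR
  , ≤g-intro GL≱X (λ j XR≤G → XR≰G (j , XR≤G)) ) X∈A

-- Stops

IsLS-unique : ∀ A G {s t} → IsLS A G s → IsLS A G t → s ≤A t
IsLS-unique A (mk _ _ _ _) (inj₁ s≈G) (inj₁ t≈G) = toGame-cancel-≤ {A} (≤g-trans (proj₁ s≈G) (proj₂ t≈G))
IsLS-unique A (mk _ _ _ _) {s} (inj₁ s≈G) (inj₂ (G∉A , _)) = ⊥-elim (G∉A (s , s≈G))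
IsLS-unique A (mk _ _ _ _) {t = t} (inj₂ (G∉A , _)) (inj₁ t≈G) = ⊥-elim (G∉A (t , t≈G))
IsLS-unique A (mk _ _ _ _) (inj₂ (_ , s-attained , _)) (inj₂ (_ , _ , t-max)) = t-max _ s-attained

IsRS-unique : ∀ A G {s t} → IsRS A G s → IsRS A G t → s ≤A t
IsRS-unique A (mk _ _ _ _) (inj₁ s≈G) (inj₁ t≈G) = toGame-cancel-≤ {A} (≤g-trans (proj₁ s≈G) (proj₂ t≈G))
IsRS-unique A (mk _ _ _ _) {s} (inj₁ s≈G) (inj₂ (G∉A , _)) = ⊥-elim (G∉A (s , s≈G))
IsRS-unique A (mk _ _ _ _) {t = t} (inj₂ (G∉A , _)) (inj₁ t≈G) = ⊥-elim (G∉A (t , t≈G))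
IsRS-unique A (mk _ _ _ _) (inj₂ (_ , _ , s-min)) (inj₂ (_ , t-attained , _)) = s-min _ t-attained

IsLS-∈A : ∀ A G {s} → IsLS A G s → G ∈A A → toGame A s ≈g G
IsLS-∈A A (mk _ _ _ _) (inj₁ s≈G)       _   = s≈G
IsLS-∈A A (mk _ _ _ _) (inj₂ (G∉A , _)) G∈A = ⊥-elim (G∉A G∈A)

IsRS-∈A : ∀ A G {s} → IsRS A G s → G ∈A A → toGame A s ≈g G
IsRS-∈A A (mk _ _ _ _) (inj₁ s≈G)       _   = s≈G
IsRS-∈A A (mk _ _ _ _) (inj₂ (G∉A , _)) G∈A = ⊥-elim (G∉A G∈A)

∈A⇒IsLS : ∀ A G → G ∈A A → ∃ (IsLS A G)
∈A⇒IsLS A (mk _ _ _ _) (a , a≈G) = a , inj₁ a≈G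

∈A⇒IsRS : ∀ A G → G ∈A A → ∃ (IsRS A G)
∈A⇒IsRS A (mk _ _ _ _) (a , a≈G) = a , inj₁ a≈G

IsLS-max : ∀ A G {s} → ¬ G ∈A A → IsLS A G s → ∀ i {r} → IsRS A (GL G i) r → r ≤A s
IsLS-max A (mk _ _ _ _) {s} G∉A (inj₁ s≈G)        = ⊥-elim (G∉A (s , s≈G))
IsLS-max A (mk _ _ _ _)     _   (inj₂ (_ , _ , max)) i r-stop = max _ (i , r-stop)

IsRS-min : ∀ A G {s} → ¬ G ∈A A → IsRS A G s → ∀ j {l} → IsLS A (GR G j) l → s ≤A l
IsRS-min A (mk _ _ _ _) {s} G∉A (inj₁ s≈G)        = ⊥-elim (G∉A (s , s≈G))
IsRS-min A (mk _ _ _ _)     _   (inj₂ (_ , _ , min)) j l-stop = min _ (j , l-stop)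

⨆ : ∀ {n} → (Fin n → ℕ) → ℕ
⨆ {zero}  _ = 0
⨆ {suc n} f = f fzero ℕ.⊔ ⨆ (λ i → f (Fin.suc i))

≤-⨆ : ∀ {n} (f : Fin n → ℕ) i → f i ℕ.≤ ⨆ f
≤-⨆ f fzero       = ℕₚ.m≤m⊔n _ _
≤-⨆ f (Fin.suc i) = ℕₚ.≤-trans (≤-⨆ (λ i → f (Fin.suc i)) i) (ℕₚ.m≤n⊔m _ _)

birthday : Game → ℕ
birthday (mk _ l _ r) = ⨆ (λ i → suc (birthday (l i))) ℕ.⊔ ⨆ (λ j → suc (birthday (r j)))

birthday-GL : ∀ H i → birthday (GL H i) ℕ.< birthday H
birthday-GL (mk _ l _ _) i = ℕₚ.≤-trans (≤-⨆ (λ i → suc (birthday (l i))) i) (ℕₚ.m≤m⊔n _ _)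

birthday-GR : ∀ H j → birthday (GR H j) ℕ.< birthday H
birthday-GR (mk _ _ _ r) j = ℕₚ.≤-trans (≤-⨆ (λ j → suc (birthday (r j))) j) (ℕₚ.m≤n⊔m _ _)

intGame-neg-suc : ∀ n → intGame (ℤ.- (+ suc n)) ≡ rightOnly (intGame (ℤ.- (+ n)))
intGame-neg-suc zero    = refl
intGame-neg-suc (suc n) = refl

≤g-birthday : ∀ H {n} → birthday H ℕ.≤ n → H ≤g intGame (+ n)
≤g-birthday H@(mk _ _ _ _) {zero} b≤0 =
  ≤g-intro (λ i → ⊥-elim (ℕₚ.n≮0 (ℕₚ.<-≤-trans (birthday-GL H i) b≤0))) (λ ())
≤g-birthday H@(mk _ l _ _) {suc n} b≤n = ≤g-intro
  (λ i n+1≤l → ≤g⇒GL≱g n+1≤l fzero (≤g-birthday (l i) (ℕ.s≤s⁻¹ (ℕₚ.<-≤-trans (birthday-GL H i) b≤n))))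
  (λ ())

birthday-≤g : ∀ H {n} → birthday H ℕ.≤ n → intGame (ℤ.- (+ n)) ≤g H
birthday-≤g H@(mk _ _ _ _) {zero} b≤0 =
  ≤g-intro (λ ()) (λ j → ⊥-elim (ℕₚ.n≮0 (ℕₚ.<-≤-trans (birthday-GR H j) b≤0)))
birthday-≤g H@(mk _ _ _ r) {suc n} b≤n = subst (_≤g H) (sym (intGame-neg-suc n)) (≤g-intro
  (λ ())
  (λ j r≤-n-1 → ≤g⇒≱gGR r≤-n-1 fzero (birthday-≤g (r j) (ℕ.s≤s⁻¹ (ℕₚ.<-≤-trans (birthday-GR H j) b≤n)))))

threshold : ∀ {P : ℕ → Set} → (∀ n → Dec (P n)) → P 0 → ∀ n → ¬ P n → ∃ λ m → P m × ¬ P (suc m)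
threshold P? P0 zero    ¬P0 = ⊥-elim (¬P0 P0)
threshold P? P0 (suc n) ¬Pn+1 with P? n
... | yes Pn = n , Pn , ¬Pn+1
... | no ¬Pn = threshold P? P0 n ¬Pn

-- H equals the largest integer n ≤ H, which lies below the birthday of H.
rightless-∈A : ∀ A {n} (l : Fin n → Game) (r : Fin 0 → Game) → mk n l 0 r ∈A A
rightless-∈A A l r =
  let H = mk _ l 0 r
      (n , n≤H , n+1≰H) =
        threshold (λ n → intGame (+ n) ≤g? H) (≤g-intro (λ ()) (λ ())) (suc (birthday H))
        (λ b+1≤H → ≤g⇒GL≱g (≤g-trans b+1≤H (≤g-birthday H ℕₚ.≤-refl)) fzero (≤g-refl _))
      H≤n = decidable-stable (H ≤g? intGame (+ n)) (λ H≰n → n+1≰H (≤g-intro (λ _ → H≰n) (λ ())))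
  in ∈A-resp-≈g (n≤H , H≤n) (integer-∈A A (+ n))

leftless-∈A : ∀ A (l : Fin 0 → Game) {n} (r : Fin n → Game) → mk 0 l n r ∈A A
leftless-∈A A l r =
  let H = mk 0 l _ r
      (n , H≤-n , H≰-n-1) =
        threshold (λ n → H ≤g? intGame (ℤ.- (+ n))) (≤g-intro (λ ()) (λ ())) (suc (birthday H))
        (λ H≤-b-1 → ≤g⇒≱gGR (≤g-trans (birthday-≤g H ℕₚ.≤-refl)
                      (subst (H ≤g_) (intGame-neg-suc (birthday H)) H≤-b-1)) fzero (≤g-refl _))
      -n≤H = decidable-stable (intGame (ℤ.- (+ n)) ≤g? H)
        (λ -n≰H → H≰-n-1 (subst (H ≤g_) (sym (intGame-neg-suc n)) (≤g-intro (λ ()) (λ _ → -n≰H))))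
  in ∈A-resp-≈g (-n≤H , H≤-n) (integer-∈A A (ℤ.- (+ n)))

argmin : ∀ {c ℓ₁ ℓ₂} (T : TotalPreorder c ℓ₁ ℓ₂) → let open TotalPreorder T in
         ∀ {n} (f : Fin (suc n) → Carrier) → ∃ λ i → ∀ j → f i ≲ f j
argmin T {zero} f = fzero , λ { fzero → TotalPreorder.refl T }
argmin T {suc n} f with argmin T (λ i → f (Fin.suc i))
... | i , min with TotalPreorder.total T (f fzero) (f (Fin.suc i))
...   | inj₁ f0≲fi =
  fzero , λ { fzero → TotalPreorder.refl T ; (Fin.suc j) → TotalPreorder.trans T f0≲fi (min j) }
...   | inj₂ fi≲f0 = Fin.suc i , λ { fzero → fi≲f0 ; (Fin.suc j) → min j }

open RawMonad (¬¬-Monad {0ℓ}) using (pure; _>>=_; rawApplicative)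

mutual
  IsRS-exists : ∀ A G → ¬ ¬ ∃ (IsRS A G)
  IsRS-exists A G@(mk _ l zero r) = pure (∈A⇒IsRS A G (rightless-∈A A l r))
  IsRS-exists A G@(mk _ _ (suc _) r) = ¬¬-excluded-middle >>= λ where
      (yes G∈A) → pure (∈A⇒IsRS A G G∈A)
      (no G∉A)  → ¬¬-map (least G∉A) (Finₚ.sequence rawApplicative (λ j → IsLS-exists A (r j)))
    where
      least : ¬ G ∈A A → (∀ j → ∃ (IsLS A (r j))) → ∃ (IsRS A G)
      least G∉A stops =
        let (j₀ , j₀-min) = argmin ℚₚ.≤-totalPreorder (λ j → proj₁ (proj₁ (stops j)))
        in proj₁ (stops j₀) , inj₂ (G∉A , (j₀ , proj₂ (stops j₀)) ,
             λ t (j , t-stop) → ℚₚ.≤-trans (j₀-min j) (IsLS-unique A (r j) (proj₂ (stops j)) t-stop))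

  IsLS-exists : ∀ A G → ¬ ¬ ∃ (IsLS A G)
  IsLS-exists A G@(mk zero l _ r) = pure (∈A⇒IsLS A G (leftless-∈A A l r))
  IsLS-exists A G@(mk (suc _) l _ _) = ¬¬-excluded-middle >>= λ where
      (yes G∈A) → pure (∈A⇒IsLS A G G∈A)
      (no G∉A)  → ¬¬-map (greatest G∉A) (Finₚ.sequence rawApplicative (λ i → IsRS-exists A (l i)))
    where
      greatest : ¬ G ∈A A → (∀ i → ∃ (IsRS A (l i))) → ∃ (IsLS A G)
      greatest G∉A stops =
        let (i₀ , i₀-max) =
              argmin (Flip.totalPreorder ℚₚ.≤-totalPreorder) (λ i → proj₁ (proj₁ (stops i)))
        in proj₁ (stops i₀) , inj₂ (G∉A , (i₀ , proj₂ (stops i₀)) ,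
             λ t (i , t-stop) → ℚₚ.≤-trans (IsRS-unique A (l i) t-stop (proj₂ (stops i))) (i₀-max i))

-- Enough for β to bound RS(M) from below for all M ≥ X and LS(K) for all K ≰ X;
-- it holds for A-numbers β ≈ X, and for X = {a | b}, β = b if nothing lies between.
record StopFloor (A : NumSys) (X : Game) (β : El A) : Set where
  field
    floor-≤  : ∀ y → X ≤g toGame A y → toGame A β ≤g toGame A y
    floor-≱  : ∀ y → X ≱g toGame A y → toGame A β ≤g toGame A y
    floor-GR : ∀ j {K l} → ¬ K ∈A A → GR X j ≤g K → IsLS A K l → toGame A β ≤g toGame A l

module _ {A X β} (F : StopFloor A X β) where
  open StopFloor F

  mutual
    RS-floor : ∀ M {r} → X ≤g M → IsRS A M r → toGame A β ≤g toGame A r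
    RS-floor (mk _ _ _ _) X≤M (inj₁ r≈M) = floor-≤ _ (≤g-trans X≤M (proj₂ r≈M))
    RS-floor (mk _ _ _ mr) X≤M (inj₂ (_ , (j , l-stop) , _)) = LS-floor (mr j) (≤g⇒≱gGR X≤M j) l-stop

    LS-floor : ∀ K {l} → X ≱g K → IsLS A K l → toGame A β ≤g toGame A l
    LS-floor (mk _ _ _ _) X≱K (inj₁ l≈K) = floor-≱ _ (λ l≤X → X≱K (≤g-trans (proj₂ l≈K) l≤X))
    LS-floor K@(mk _ kl _ _) X≱K l-stop@(inj₂ (K∉A , _)) = decidable-stable (_ ≤g? _) λ β≰l →
      [ (λ (i , X≤KL) → IsRS-exists A (kl i) λ (r , r-stop) →
           β≰l (≤g-trans (RS-floor (kl i) X≤KL r-stop)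
                         (toGame-mono-≤ {A} (IsLS-max A K K∉A l-stop i r-stop))))
      , (λ (j , XR≤K) → β≰l (floor-GR j K∉A XR≤K l-stop))
      ] (≰g-witness X≱K)

record StopCeiling (A : NumSys) (X : Game) (β : El A) : Set where
  field
    ceiling-≤  : ∀ y → toGame A y ≤g X → toGame A y ≤g toGame A β
    ceiling-≱  : ∀ y → toGame A y ≱g X → toGame A y ≤g toGame A β
    ceiling-GL : ∀ i {K r} → ¬ K ∈A A → K ≤g GL X i → IsRS A K r → toGame A r ≤g toGame A β

module _ {A X β} (C : StopCeiling A X β) where
  open StopCeiling C

  mutual
    LS-ceiling : ∀ M {l} → M ≤g X → IsLS A M l → toGame A l ≤g toGame A β
    LS-ceiling (mk _ _ _ _) M≤X (inj₁ l≈M) = ceiling-≤ _ (≤g-trans (proj₁ l≈M) M≤X)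
    LS-ceiling (mk _ ml _ _) M≤X (inj₂ (_ , (i , r-stop) , _)) = RS-ceiling (ml i) (≤g⇒GL≱g M≤X i) r-stop

    RS-ceiling : ∀ K {r} → K ≱g X → IsRS A K r → toGame A r ≤g toGame A β
    RS-ceiling (mk _ _ _ _) K≱X (inj₁ r≈K) = ceiling-≱ _ (λ X≤r → K≱X (≤g-trans X≤r (proj₁ r≈K)))
    RS-ceiling K@(mk _ _ _ kr) K≱X r-stop@(inj₂ (K∉A , _)) = decidable-stable (_ ≤g? _) λ r≰β →
      [ (λ (i , K≤XL) → r≰β (ceiling-GL i K∉A K≤XL r-stop))
      , (λ (j , KR≤X) → IsLS-exists A (kr j) λ (l , l-stop) →
           r≰β (≤g-trans (toGame-mono-≤ {A} (IsRS-min A K K∉A r-stop j l-stop))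
                         (LS-ceiling (kr j) KR≤X l-stop)))
      ] (≰g-witness K≱X)

number-floor : ∀ {A X β} → HereditarilyIn A X → toGame A β ≈g X → StopFloor A X β
number-floor {A} {X} {β} hX@(hereditary _ _ hR) β≈X = record
  { floor-≤  = λ y X≤y → ≤g-trans (proj₁ β≈X) X≤y
  ; floor-≱  = λ y X≱y → toGame-≱g⇒≤g {A} {β} {y} (λ y≤β → X≱y (≤g-trans y≤β (proj₁ β≈X)))
  ; floor-GR = λ j {K} K∉A XR≤K l-stop →
      let (c , c≈XR) = hereditary-∈A (hR j)
      in ≤g-trans (≤g-trans (proj₁ β≈X) (≤g-trans (≤gGR hX j) (proj₂ c≈XR)))
                  (LS-floor (number-floor (hR j) c≈XR) K
                     (λ K≤XR → K∉A (∈A-resp-≈g (XR≤K , K≤XR) (c , c≈XR))) l-stop)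
  }

number-ceiling : ∀ {A X β} → HereditarilyIn A X → toGame A β ≈g X → StopCeiling A X β
number-ceiling {A} {X} {β} hX@(hereditary _ hL _) β≈X = record
  { ceiling-≤  = λ y y≤X → ≤g-trans y≤X (proj₂ β≈X)
  ; ceiling-≱  = λ y y≱X → toGame-≱g⇒≤g {A} {y} {β} (λ β≤y → y≱X (≤g-trans (proj₂ β≈X) β≤y))
  ; ceiling-GL = λ i {K} K∉A K≤XL r-stop →
      let (c , c≈XL) = hereditary-∈A (hL i)
      in ≤g-trans (RS-ceiling (number-ceiling (hL i) c≈XL) K
                     (λ XL≤K → K∉A (∈A-resp-≈g (XL≤K , K≤XL) (c , c≈XL))) r-stop)
                  (≤g-trans (≤g-trans (proj₁ c≈XL) (GL≤g hX i)) (proj₂ β≈X))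
  }

-- Games {a | b} with no element of A strictly between a and b

NoneBetween : ∀ A → El A → El A → Set
NoneBetween A a b = ∀ y → toGame A a ≱g toGame A y → toGame A y ≱g toGame A b → ⊥

∉A⇒NoneBetween : ∀ {A a b} → K ≈g ⟨ toGame A a ∣ toGame A b ⟩ → ¬ K ∈A A → NoneBetween A a b
∉A⇒NoneBetween {A = A} K≈ab K∉A y a≱y y≱b =
  K∉A (∈A-resp-≈g (≈g-sym K≈ab) (fits⇒∈A (toGame-hereditary A y) ((λ _ → a≱y) , (λ _ → y≱b))))

≤g-⟨∣⟩ : ∀ {A a b} y → NoneBetween A a b → toGame A y ≱g toGame A b →
         toGame A y ≤g ⟨ toGame A a ∣ toGame A b ⟩
≤g-⟨∣⟩ {A} y none y≱b with toGame-hereditary A y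
... | hy@(hereditary _ hL _) = ≤g-intro
  (λ i ab≤yL → let (c , c≈yL) = hereditary-∈A (hL i) in
     none c (≤g⇒GL≱g (≤g-trans ab≤yL (proj₂ c≈yL)) fzero)
            (λ b≤c → y≱b (≤g-trans b≤c (≤g-trans (proj₁ c≈yL) (GL≤g hy i)))))
  (λ _ → y≱b)

⟨∣⟩-≤g : ∀ {A a b} y → NoneBetween A a b → toGame A a ≱g toGame A y →
         ⟨ toGame A a ∣ toGame A b ⟩ ≤g toGame A y
⟨∣⟩-≤g {A} y none a≱y with toGame-hereditary A y
... | hy@(hereditary _ _ hR) = ≤g-intro
  (λ _ → a≱y)
  (λ j yR≤ab → let (c , c≈yR) = hereditary-∈A (hR j) in
     none c (λ c≤a → a≱y (≤g-trans (≤g-trans (≤gGR hy j) (proj₂ c≈yR)) c≤a))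
            (≤g⇒≱gGR (≤g-trans (proj₁ c≈yR) yR≤ab) fzero))

⟨∣⟩-floor : ∀ {A a b} → NoneBetween A a b → StopFloor A ⟨ toGame A a ∣ toGame A b ⟩ b
⟨∣⟩-floor {A} {a} {b} none = record
  { floor-≤  = λ y ab≤y → decidable-stable (_ ≤g? _) (none y (≤g⇒GL≱g ab≤y fzero))
  ; floor-≱  = λ y ab≱y → decidable-stable (_ ≤g? _) (λ y≱b → ab≱y (≤g-⟨∣⟩ y none y≱b))
  ; floor-GR = λ { fzero {K} K∉A b≤K l-stop →
      LS-floor (number-floor (toGame-hereditary A b) ≈g-refl) K
        (λ K≤b → K∉A (∈A-resp-≈g (b≤K , K≤b) (b , ≈g-refl))) l-stop }
  }

⟨∣⟩-ceiling : ∀ {A a b} → NoneBetween A a b → StopCeiling A ⟨ toGame A a ∣ toGame A b ⟩ a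
⟨∣⟩-ceiling {A} {a} {b} none = record
  { ceiling-≤  = λ y y≤ab → decidable-stable (_ ≤g? _) (λ a≱y → none y a≱y (≤g⇒≱gGR y≤ab fzero))
  ; ceiling-≱  = λ y y≱ab → decidable-stable (_ ≤g? _) (λ a≱y → y≱ab (⟨∣⟩-≤g y none a≱y))
  ; ceiling-GL = λ { fzero {K} K∉A K≤a r-stop →
      RS-ceiling (number-ceiling (toGame-hereditary A a) ≈g-refl) K
        (λ a≤K → K∉A (∈A-resp-≈g (a≤K , K≤a) (a , ≈g-refl))) r-stop }
  }

≱g⇒RS-≤g : ∀ {A a b s x} → K ≈g ⟨ toGame A a ∣ toGame A b ⟩ → ¬ K ∈A A → IsRS A K s →
           K ≱g toGame A x → toGame A s ≤g toGame A x
≱g⇒RS-≤g {K} {A} {b = b} {x = x} K≈ab K∉A s-stop K≱x = ≤g-trans s≤b b≤x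
  where
    none = ∉A⇒NoneBetween K≈ab K∉A
    s≤b = RS-ceiling (number-ceiling (toGame-hereditary A b) ≈g-refl) K
            (λ b≤K → ≱gGR _ fzero (≤g-trans b≤K (proj₁ K≈ab))) s-stop
    b≤x = decidable-stable (_ ≤g? _) (λ x≱b → K≱x (≤g-trans (≤g-⟨∣⟩ x none x≱b) (proj₂ K≈ab)))

≤g⇒≱g-RS : ∀ {A a b r x} → K ≈g ⟨ toGame A a ∣ toGame A b ⟩ → ¬ K ∈A A → IsRS A K r →
           toGame A x ≤g K → toGame A x ≱g toGame A r
≤g⇒≱g-RS {K} K≈ab K∉A r-stop x≤K r≤x =
  ≤g⇒≱gGR (≤g-trans x≤K (proj₁ K≈ab)) fzero (≤g-trans b≤r r≤x)
  where
    none = ∉A⇒NoneBetween K≈ab K∉A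
    b≤r = RS-floor (⟨∣⟩-floor none) K (proj₂ K≈ab) r-stop

≱g⇒≤g-LS : ∀ {A a b t x} → K ≈g ⟨ toGame A a ∣ toGame A b ⟩ → ¬ K ∈A A → IsLS A K t →
           toGame A x ≱g K → toGame A x ≤g toGame A t
≱g⇒≤g-LS {K} {A} {a} {x = x} K≈ab K∉A t-stop x≱K = ≤g-trans x≤a a≤t
  where
    none = ∉A⇒NoneBetween K≈ab K∉A
    a≤t = LS-floor (number-floor (toGame-hereditary A a) ≈g-refl) K
            (λ K≤a → GL≱g _ fzero (≤g-trans (proj₂ K≈ab) K≤a)) t-stop
    x≤a = decidable-stable (_ ≤g? _) (λ a≱x → x≱K (≤g-trans (proj₁ K≈ab) (⟨∣⟩-≤g x none a≱x)))

≤g⇒≱g-LS : ∀ {A a b l x} → K ≈g ⟨ toGame A a ∣ toGame A b ⟩ → ¬ K ∈A A → IsLS A K l →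
           K ≤g toGame A x → toGame A l ≱g toGame A x
≤g⇒≱g-LS {K} K≈ab K∉A l-stop K≤x x≤l =
  ≤g⇒GL≱g (≤g-trans (proj₂ K≈ab) K≤x) fzero (≤g-trans x≤l l≤a)
  where
    none = ∉A⇒NoneBetween K≈ab K∉A
    l≤a = LS-ceiling (⟨∣⟩-ceiling none) K (proj₁ K≈ab) l-stop

left-guide-fits : ∀ A G {i₀ x} → InGdL A G i₀ → GL G i₀ ≱g toGame A x →
                  (∀ i → GL G i ∈AA A) → ∀ i → GL G i ≱g toGame A x
left-guide-fits A G@(mk _ gl _ _) {i₀} {x} (G∉A , s , s-stop , guide) GL₀≱x options i x≤GL =
  IsRS-exists A (gl i) λ (r , r-stop) →
    let r≤s = toGame-mono-≤ {A} (IsLS-max A G G∉A s-stop i r-stop)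
    in [ (λ (_ , GL₀≈s) → GL₀≱x (begin
           toGame A x ≲⟨ RS-floor (number-floor (toGame-hereditary A x) ≈g-refl) (gl i) x≤GL r-stop ⟩
           toGame A r ≲⟨ r≤s ⟩
           toGame A s ≈⟨ ≈g-sym GL₀≈s ⟩
           gl i₀      ∎))
       , (λ (no-GL≈s , s-stop₀) →
           let s≤x = ≱g⇒RS-≤g (proj₂ (proj₂ (options i₀)))
                       (λ GL₀∈A → no-GL≈s (i₀ , ≈g-sym (IsRS-∈A A (gl i₀) s-stop₀ GL₀∈A))) s-stop₀ GL₀≱x
               GL∉A = λ GL∈A → let r≈GL = IsRS-∈A A (gl i) r-stop GL∈A in
                        no-GL≈s (i , ≤g-trans (proj₂ r≈GL) r≤s , ≤g-trans s≤x x≤GL)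
           in ≤g⇒≱g-RS (proj₂ (proj₂ (options i))) GL∉A r-stop x≤GL (≤g-trans r≤s s≤x))
       ] guide
  where open ≤g-Reasoning

right-guide-fits : ∀ A G {j₀ x} → InGdR A G j₀ → toGame A x ≱g GR G j₀ →
                   (∀ j → GR G j ∈AA A) → ∀ j → toGame A x ≱g GR G j
right-guide-fits A G@(mk _ _ _ gr) {j₀} {x} (G∉A , t , t-stop , guide) x≱GR₀ options j GR≤x =
  IsLS-exists A (gr j) λ (l , l-stop) →
    let t≤l = toGame-mono-≤ {A} (IsRS-min A G G∉A t-stop j l-stop)
    in [ (λ (_ , GR₀≈t) → x≱GR₀ (begin
           gr j₀      ≈⟨ GR₀≈t ⟩
           toGame A t ≲⟨ t≤l ⟩
           toGame A l ≲⟨ LS-ceiling (number-ceiling (toGame-hereditary A x) ≈g-refl) (gr j) GR≤x l-stop ⟩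
           toGame A x ∎))
       , (λ (no-GR≈t , t-stop₀) →
           let x≤t = ≱g⇒≤g-LS (proj₂ (proj₂ (options j₀)))
                       (λ GR₀∈A → no-GR≈t (j₀ , ≈g-sym (IsLS-∈A A (gr j₀) t-stop₀ GR₀∈A))) t-stop₀ x≱GR₀
               GR∉A = λ GR∈A → let l≈GR = IsLS-∈A A (gr j) l-stop GR∈A in
                        no-GR≈t (j , ≤g-trans GR≤x x≤t , ≤g-trans t≤l (proj₁ l≈GR))
           in ≤g⇒≱g-LS (proj₂ (proj₂ (options j))) GR∉A l-stop GR≤x (≤g-trans x≤t t≤l))
       ] guide
  where open ≤g-Reasoning

lemma2 : (A : NumSys) (G : Game) →
         Diamond A G →
         (∀ i → GL G i ∈AA A) →
         (∀ j → GR G j ∈AA A) →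
         G ∈A A
lemma2 A G (inj₁ G∈A) _ _ = G∈A
lemma2 A G (inj₂ (i₀ , j₀ , x , guideL , guideR , GL₀≱x , x≱GR₀)) optionsL optionsR =
  fits⇒∈A (toGame-hereditary A x)
    (left-guide-fits A G guideL GL₀≱x optionsL , right-guide-fits A G guideR x≱GR₀ optionsR)
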